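{- Let $\pi$ be a permutation with no key mid-$123$ entries. Then $\pi$ has no mid-$123$ entries at all; in particular, $\pi$ avoids the pattern $123$.
   Context: Let $\pi=\pi_1\cdots\pi_n$ be a permutation. An entry $\pi_i$ is a mid-$123$ entry if there exist $h<i<l$ with $\pi_h<\pi_i<\pi_l$ (i.e. $\pi_i$ serves as the "2" of a $123$ pattern). An entry $\pi_l$ is a right-to-left maximum if $\pi_l>\pi_m$ for all $m>l$. A mid-$123$ entry $\pi_i$ is key if its immediate predecessor $\pi_{i-1}$ either satisfies $\pi_{i-1}<\pi_i$ or is a right-to-left maximum. A permutation avoids $123$ if there are no $h<i<l$ with $\pi_h<\pi_i<\pi_l$. -}

module Defs where

open import Data.Nat using (ℕ; suc)
open import Data.Fin using (Fin; toℕ; _<_)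
open import Data.Fin.Permutation using (Permutation′; _⟨$⟩ʳ_)
open import Data.Product using (∃-syntax; _×_)
open import Data.Sum using (_⊎_)
open import Relation.Binary.PropositionalEquality using (_≡_)
open import Relation.Nullary using (¬_)

-- A permutation π = π₁⋯πₙ of length n is a bijection Fin n ↔ Fin n;
-- position i (0-based) carries the entry π ⟨$⟩ʳ i.

Mid123 : ∀ {n} → Permutation′ n → Fin n → Set
Mid123 π i = ∃[ h ] ∃[ l ] (h < i × i < l × (π ⟨$⟩ʳ h) < (π ⟨$⟩ʳ i) × (π ⟨$⟩ʳ i) < (π ⟨$⟩ʳ l))

RLMax : ∀ {n} → Permutation′ n → Fin n → Set
RLMax π l = ∀ m → l < m → (π ⟨$⟩ʳ m) < (π ⟨$⟩ʳ l)

KeyMid123 : ∀ {n} → Permutation′ n → Fin n → Set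
KeyMid123 π i = Mid123 π i ×
  (∀ j → suc (toℕ j) ≡ toℕ i → (π ⟨$⟩ʳ j) < (π ⟨$⟩ʳ i) ⊎ RLMax π j)

Avoids123 : ∀ {n} → Permutation′ n → Set
Avoids123 π = ∀ h i l → h < i → i < l →
  ¬ ((π ⟨$⟩ʳ h) < (π ⟨$⟩ʳ i) × (π ⟨$⟩ʳ i) < (π ⟨$⟩ʳ l))

module Submission where

open import Defs
open import Data.Nat using (ℕ; zero; suc; s≤s⁻¹)
import Data.Nat.Properties as ℕ
open import Data.Fin using (toℕ; _<_; _<?_)
open import Data.Fin.Properties using (toℕ-injective; <-cmp; <-irrefl)
open import Data.Fin.Permutation using (Permutation′; _⟨$⟩ʳ_)
open import Data.Product using (_×_; _,_)
open import Data.Sum using (_⊎_; inj₁; inj₂)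
open import Function.Bundles using (Injection)
open import Function.Properties.Inverse using (↔⇒↣)
open import Relation.Binary.Definitions using (tri<; tri≈; tri>)
open import Relation.Binary.PropositionalEquality using (_≡_; refl; sym; trans)
open import Relation.Nullary using (¬_; yes; no; contradiction)

-- Take a mid-123 entry π_i in leftmost position. It is not key,
-- so its predecessor π_j exceeds π_i and is not a right-to-left maximum:
-- some later π_m exceeds π_j. With the witness π_h < π_i (h < j, since
-- π_j > π_i), the triple h < j < m makes π_j a mid-123 entry further left.

module _ {n : ℕ} (π : Permutation′ n) where

  ⟨$⟩ʳ-injective : ∀ {a b} → π ⟨$⟩ʳ a ≡ π ⟨$⟩ʳ b → a ≡ b
  ⟨$⟩ʳ-injective = Injection.injective (↔⇒↣ π)

  ¬Mid123∧ascent⇒RLMax : ∀ {h j} → h < j → π ⟨$⟩ʳ h < π ⟨$⟩ʳ j →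
                         ¬ Mid123 π j → RLMax π j
  ¬Mid123∧ascent⇒RLMax {h} {j} h<j πh<πj ¬mid m j<m with <-cmp (π ⟨$⟩ʳ m) (π ⟨$⟩ʳ j)
  ... | tri< πm<πj _ _ = πm<πj
  ... | tri≈ _ πm≡πj _ = contradiction j<m (<-irrefl (sym (⟨$⟩ʳ-injective πm≡πj)))
  ... | tri> _ _ πj<πm = contradiction (h , m , h<j , j<m , πh<πj , πj<πm) ¬mid

  predecessor-¬Mid123⇒key-condition : ∀ {i j} → Mid123 π i → suc (toℕ j) ≡ toℕ i →
                           ¬ Mid123 π j → π ⟨$⟩ʳ j < π ⟨$⟩ʳ i ⊎ RLMax π j
  predecessor-¬Mid123⇒key-condition {i} {j} (h , _ , h<i , _ , πh<πi , _) j+1≡i ¬mid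
    with π ⟨$⟩ʳ j <? π ⟨$⟩ʳ i
  ... | yes πj<πi = inj₁ πj<πi
  ... | no πj≮πi = inj₂ (¬Mid123∧ascent⇒RLMax h<j πh<πj ¬mid)
    where
    πh<πj : π ⟨$⟩ʳ h < π ⟨$⟩ʳ j
    πh<πj = ℕ.<-≤-trans πh<πi (ℕ.≮⇒≥ πj≮πi)
    h<j : h < j
    h<j with ℕ.m≤n⇒m<n∨m≡n (s≤s⁻¹ (ℕ.<-≤-trans h<i (ℕ.≤-reflexive (sym j+1≡i))))
    ... | inj₁ h<j = h<j
    ... | inj₂ h≡j with toℕ-injective h≡j
    ...   | refl = contradiction πh<πi πj≮πi

  no-key⇒no-Mid123 : (∀ i → ¬ KeyMid123 π i) → ∀ i → ¬ Mid123 π i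
  no-key⇒no-Mid123 noKey i = go (toℕ i) i refl
    where
    go : ∀ k i → toℕ i ≡ k → ¬ Mid123 π i
    go zero    i i≡0   (h , _ , h<i , _) = ℕ.n≮0 (ℕ.<-≤-trans h<i (ℕ.≤-reflexive i≡0))
    go (suc k) i i≡1+k mid = noKey i (mid , λ j j+1≡i →
      predecessor-¬Mid123⇒key-condition mid j+1≡i (go k j (ℕ.suc-injective (trans j+1≡i i≡1+k))))

  no-Mid123⇒Avoids123 : (∀ i → ¬ Mid123 π i) → Avoids123 π
  no-Mid123⇒Avoids123 noMid h i l h<i i<l (πh<πi , πi<πl) =
    noMid i (h , l , h<i , i<l , πh<πi , πi<πl)

lemma1 : (n : ℕ) (π : Permutation′ n) →
    (∀ i → ¬ KeyMid123 π i) →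
    (∀ i → ¬ Mid123 π i) × Avoids123 π
lemma1 n π noKey = noMid , no-Mid123⇒Avoids123 π noMid
  where
  noMid : ∀ i → ¬ Mid123 π i
  noMid = no-key⇒no-Mid123 π noKey
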